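{- Let $h,k\ge 1$ be integers, let $U$ be a graph with $\chi_2(U)\ge h$, and let $G$ be the graph obtained by taking $k+1$ disjoint copies $U_0,\ldots,U_k$ of $U$ and adding a vertex $a$ adjacent to every vertex of $\bigcup_{i=0}^k V(U_i)$. Then for any integer $k_0\in\{1,\ldots,k\}$ and any 2-ranking $\varphi:V(G)\to\{k_0,\ldots,k\}$ of $G$, we have $\varphi(a)\ge k_0+h$.
   Context: A colouring $\varphi:V(G)\to\mathbb{N}$ is a 2-ranking if for every non-trivial path $u_0,\ldots,u_p$ in $G$ of length $p\le 2$, either $\varphi(u_0)\neq\varphi(u_p)$ or $\varphi(u_0)<\max\{\varphi(u_0),\ldots,\varphi(u_p)\}$; $\chi_2(G)$ is the minimum $k$ such that $G$ has a 2-ranking with colours $\{1,\ldots,k\}$. -}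

module Defs where

open import Data.Nat using (ℕ; zero; suc; _≤_; _<_; _⊔_)
open import Data.Fin using (Fin; zero; suc; inject₁; fromℕ)
open import Data.Maybe using (Maybe; just; nothing)
open import Data.Product using (_×_; Σ; _,_)
open import Data.Sum using (_⊎_)
open import Data.Unit using (⊤)
open import Data.Empty using (⊥)
open import Relation.Nullary using (¬_)
open import Relation.Binary.PropositionalEquality using (_≡_; _≢_; refl)
open import Function.Definitions using (Injective)

record Graph (V : Set) : Set₁ where
  field
    Adj    : V → V → Set
    sym    : ∀ {u v} → Adj u v → Adj v u
    irrefl : ∀ {u} → ¬ Adj u u
open Graph public

record Path {V : Set} (G : Graph V) (p : ℕ) : Set where
  field
    vtx  : Fin (suc p) → V
    inj  : Injective _≡_ _≡_ vtx
    step : ∀ (i : Fin p) → Adj G (vtx (inject₁ i)) (vtx (suc i))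
open Path public

maxUpTo : (p : ℕ) → (Fin (suc p) → ℕ) → ℕ
maxUpTo zero    f = f zero
maxUpTo (suc p) f = f zero ⊔ maxUpTo p (λ i → f (suc i))

Is2Ranking : {V : Set} → Graph V → (V → ℕ) → Set
Is2Ranking G φ =
  ∀ (p : ℕ) → 1 ≤ p → p ≤ 2 → (P : Path G p) →
    (φ (vtx P zero) ≢ φ (vtx P (fromℕ p)))
    ⊎ (φ (vtx P zero) < maxUpTo p (λ i → φ (vtx P i)))

-- χ₂(G) ≥ h : every 2-ranking with colours in {1,…,k} has k ≥ h
-- (equivalently, the minimum such k is at least h).
Chi2≥ : {V : Set} → Graph V → ℕ → Set
Chi2≥ {V} G h = ∀ (k : ℕ) (φ : V → ℕ) → Is2Ranking G φ →
                  (∀ v → 1 ≤ φ v × φ v ≤ k) → h ≤ k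

-- k+1 disjoint copies U₀,…,U_k of U (vertices just (i , u)) plus an apex
-- vertex a = nothing adjacent to every vertex of the copies.
ApexAdj : {V : Set} → Graph V → (k : ℕ) → Maybe (Fin (suc k) × V) → Maybe (Fin (suc k) × V) → Set
ApexAdj U k nothing  nothing  = ⊥
ApexAdj U k nothing  (just _) = ⊤
ApexAdj U k (just _) nothing  = ⊤
ApexAdj U k (just (i , u)) (just (j , v)) = (i ≡ j) × Adj U u v

apexSym : {V : Set} (U : Graph V) (k : ℕ) → ∀ {x y} → ApexAdj U k x y → ApexAdj U k y x
apexSym U k {nothing} {just _} t = t
apexSym U k {just _} {nothing} t = t
apexSym U k {just _} {just _} (refl , e) = refl , sym U e

apexIrrefl : {V : Set} (U : Graph V) (k : ℕ) → ∀ {x} → ¬ ApexAdj U k x x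
apexIrrefl U k {nothing} ()
apexIrrefl U k {just _} (_ , e) = irrefl U e

ApexCopies : {V : Set} → Graph V → (k : ℕ) → Graph (Maybe (Fin (suc k) × V))
ApexCopies U k = record { Adj = ApexAdj U k ; sym = apexSym U k ; irrefl = apexIrrefl U k }

module Submission where

-- Idea.  Let c = φ(a).  Either every copy Uᵢ contains a vertex wᵢ with
-- φ(wᵢ) ≥ c, or some copy U_{i₀} is coloured entirely below c.
--
-- * In the first case the k+1 colours φ(wᵢ) lie in {k₀,…,k} ⊆ {1,…,k}, so by
--   pigeonhole two copies i ≠ j have φ(wᵢ) = φ(wⱼ).  The path wᵢ, a, wⱼ then
--   forces φ(wᵢ) < φ(a) = c (common-neighbour lemma), a contradiction.
-- * In the second case restricting φ to U_{i₀} gives a 2-ranking of U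
--   (2-rankings pull back along graph embeddings), and shifting its colours
--   by x ↦ x − k₀ + 1 keeps it a 2-ranking with colours in {1,…,c − k₀}.
--   Hence h ≤ c − k₀ by the hypothesis χ₂(U) ≥ h, i.e. k₀ + h ≤ c.

open import Defs
open import Data.Nat using (ℕ; suc; zero; pred; _≤_; _+_; _<_; _∸_; _⊔_; _≤?_; z≤n; s≤s)
open import Data.Nat.Properties
open import Data.Fin using (Fin; zero; suc; toℕ; fromℕ<)
open import Data.Fin.Properties using (pigeonhole; any?; all?; ¬∀⟶∃¬; fromℕ<-injective)
open import Data.Product using (_×_; _,_; proj₁; proj₂; ∃; ∃₂)
open import Data.Product.Properties using (,-injective)
open import Data.Sum using (_⊎_; inj₁; inj₂)
open import Data.Maybe using (Maybe; nothing; just)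
open import Data.Maybe.Properties using (just-injective)
open import Function using (_∘_)
open import Function.Definitions using (Injective)
open import Relation.Nullary using (¬_; Dec; yes; no; contradiction)
open import Relation.Binary.PropositionalEquality using (_≡_; _≢_; refl; cong; trans; subst)
  renaming (sym to ≡-sym)

maxUpTo-map : (g : ℕ → ℕ) → (∀ x y → g (x ⊔ y) ≡ g x ⊔ g y) →
              (p : ℕ) (f : Fin (suc p) → ℕ) →
              maxUpTo p (g ∘ f) ≡ g (maxUpTo p f)
maxUpTo-map g g-⊔ zero    f = refl
maxUpTo-map g g-⊔ (suc p) f =
  trans (cong (g (f zero) ⊔_) (maxUpTo-map g g-⊔ p (f ∘ suc)))
        (≡-sym (g-⊔ (f zero) _))

ranking-pullback : {V W : Set} (U : Graph V) (G : Graph W) (e : V → W) →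
                   Injective _≡_ _≡_ e → (∀ {u v} → Adj U u v → Adj G (e u) (e v)) →
                   (φ : W → ℕ) → Is2Ranking G φ → Is2Ranking U (φ ∘ e)
ranking-pullback U G e e-inj e-adj φ rk p 1≤p p≤2 P = rk p 1≤p p≤2 image
  where
  image : Path G p
  image = record { vtx  = e ∘ vtx P
                 ; inj  = inj P ∘ e-inj
                 ; step = e-adj ∘ step P }

-- Lowering all colours by a common amount (keeping them positive) preserves
-- being a 2-ranking: x ↦ suc (x ∸ m) is injective and strictly monotone on x ≥ m.
ranking-shift : {V : Set} (G : Graph V) (φ : V → ℕ) (m : ℕ) →
                (∀ v → m ≤ φ v) → Is2Ranking G φ →
                Is2Ranking G (λ v → suc (φ v ∸ m))
ranking-shift G φ m m≤φ rk p 1≤p p≤2 P with rk p 1≤p p≤2 P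
... | inj₁ φ≢ = inj₁ (φ≢ ∘ ∸-cancelʳ-≡ (m≤φ _) (m≤φ _) ∘ suc-injective)
... | inj₂ φ< = inj₂ (subst (suc (φ (vtx P zero) ∸ m) <_)
                        (≡-sym (maxUpTo-map shift shift-⊔ p (φ ∘ vtx P)))
                        (s≤s (∸-monoˡ-< φ< (m≤φ _))))
  where
  shift : ℕ → ℕ
  shift x = suc (x ∸ m)
  shift-⊔ : ∀ x y → shift (x ⊔ y) ≡ shift x ⊔ shift y
  shift-⊔ x y = cong suc (∸-distribʳ-⊔ m x y)

-- Two distinct neighbours u, w of a vertex a with the same colour force
-- φ(a) to exceed that colour: apply the ranking condition to the path u, a, w.
common-neighbour : {V : Set} (G : Graph V) (φ : V → ℕ) → Is2Ranking G φ →
                   {u a w : V} → u ≢ w → Adj G u a → Adj G a w →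
                   φ u ≡ φ w → φ u < φ a
common-neighbour {V} G φ rk {u} {a} {w} u≢w ua aw φu≡φw with rk 2 (s≤s z≤n) ≤-refl uaw
  where
  vertex : Fin 3 → V
  vertex zero             = u
  vertex (suc zero)       = a
  vertex (suc (suc zero)) = w
  a≢u : a ≢ u
  a≢u refl = irrefl G ua
  a≢w : a ≢ w
  a≢w refl = irrefl G aw
  vertex-inj : Injective _≡_ _≡_ vertex
  vertex-inj {zero}             {zero}             _ = refl
  vertex-inj {zero}             {suc zero}         e = contradiction (≡-sym e) a≢u
  vertex-inj {zero}             {suc (suc zero)}   e = contradiction e u≢w
  vertex-inj {suc zero}         {zero}             e = contradiction e a≢u
  vertex-inj {suc zero}         {suc zero}         _ = refl
  vertex-inj {suc zero}         {suc (suc zero)}   e = contradiction e a≢w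
  vertex-inj {suc (suc zero)}   {zero}             e = contradiction (≡-sym e) u≢w
  vertex-inj {suc (suc zero)}   {suc zero}         e = contradiction (≡-sym e) a≢w
  vertex-inj {suc (suc zero)}   {suc (suc zero)}   _ = refl
  uaw : Path G 2
  uaw = record { vtx = vertex ; inj = vertex-inj
               ; step = λ { zero → ua ; (suc zero) → aw } }
... | inj₁ φu≢φw = contradiction φu≡φw φu≢φw
... | inj₂ φu<max with φ a ≤? φ u
...   | no  φa≰φu = ≰⇒> φa≰φu
...   | yes φa≤φu = contradiction φu<max (≤⇒≯ max≤φu)
  where
  max≤φu : φ u ⊔ (φ a ⊔ φ w) ≤ φ u
  max≤φu = ⊔-lub ≤-refl (⊔-lub φa≤φu (≤-reflexive (≡-sym φu≡φw)))

colour-collision : (k : ℕ) (c : Fin (suc k) → ℕ) → (∀ i → 1 ≤ c i × c i ≤ k) →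
                   ∃₂ λ i j → i ≢ j × c i ≡ c j
colour-collision k c range with pigeonhole ≤-refl index
  where
  pred< : ∀ {x} → 1 ≤ x → x ≤ k → pred x < k
  pred< (s≤s z≤n) x≤k = x≤k
  index : Fin (suc k) → Fin k
  index i = fromℕ< (pred< (proj₁ (range i)) (proj₂ (range i)))
... | i , j , i<j , same-index =
  i , j , i≢j , positive-pred-injective (proj₁ (range i)) (proj₁ (range j))
                  (fromℕ<-injective _ _ _ _ same-index)
  where
  i≢j : i ≢ j
  i≢j i≡j = <-irrefl (cong toℕ i≡j) i<j
  positive-pred-injective : ∀ {x y} → 1 ≤ x → 1 ≤ y → pred x ≡ pred y → x ≡ y
  positive-pred-injective (s≤s z≤n) (s≤s z≤n) = cong suc

every-row-or-empty-row : {m n : ℕ} (R : Fin m → Fin n → Set) →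
                         (∀ i j → Dec (R i j)) →
                         (∀ i → ∃ (R i)) ⊎ (∃ λ i → ∀ j → ¬ R i j)
every-row-or-empty-row {m} R R? with all? (λ i → any? (R? i))
... | yes every = inj₁ every
... | no  ¬every with ¬∀⟶∃¬ m _ (λ i → any? (R? i)) ¬every
...   | i , ¬hit = inj₂ (i , λ j r → ¬hit (j , r))

copy-inj : {V : Set} (k : ℕ) (i : Fin (suc k)) →
           Injective _≡_ _≡_ (λ (v : V) → just (i , v))
copy-inj k i = proj₂ ∘ ,-injective ∘ just-injective

-- In a 2-ranking of the apex graph (over a finite U) with colours in {1,…,k},
-- some copy is coloured entirely below the apex: otherwise pigeonhole yields
-- two copies with equally coloured vertices of colour ≥ φ(a), against
-- common-neighbour.
some-copy-below-apex : {n : ℕ} (U : Graph (Fin n)) (k : ℕ)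
                       (φ : Maybe (Fin (suc k) × Fin n) → ℕ) →
                       Is2Ranking (ApexCopies U k) φ → (∀ v → 1 ≤ φ v × φ v ≤ k) →
                       ∃ λ i₀ → ∀ v → φ (just (i₀ , v)) < φ nothing
some-copy-below-apex U k φ rk range
  with every-row-or-empty-row (λ i v → φ nothing ≤ φ (just (i , v))) (λ i v → _ ≤? _)
... | inj₂ (i₀ , ¬high) = i₀ , λ v → ≰⇒> (¬high v)
... | inj₁ high with colour-collision k (λ i → φ (just (i , proj₁ (high i)))) (λ i → range _)
...   | i , j , i≢j , same = contradiction (proj₂ (high i)) (<⇒≱ (common-neighbour
                               (ApexCopies U k) φ rk (i≢j ∘ proj₁ ∘ ,-injective ∘ just-injective)
                               _ _ same))

-- If copy i₀ is coloured in {k₀,…,φ(a) − 1}, then its colours shifted down to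
-- {1,…,φ(a) − k₀} form a 2-ranking of U, so χ₂(U) ≥ h gives k₀ + h ≤ φ(a).
apex-above-low-copy : {V : Set} (U : Graph V) (h k k₀ : ℕ) → Chi2≥ U h →
                      (φ : Maybe (Fin (suc k) × V) → ℕ) → Is2Ranking (ApexCopies U k) φ →
                      (∀ v → k₀ ≤ φ v) → (i₀ : Fin (suc k)) →
                      (∀ v → φ (just (i₀ , v)) < φ nothing) →
                      k₀ + h ≤ φ nothing
apex-above-low-copy {V} U h k k₀ χ₂U≥h φ rk k₀≤φ i₀ below =
  ≤-trans (+-monoʳ-≤ k₀ h≤c∸k₀) (≤-reflexive (m+[n∸m]≡n (k₀≤φ nothing)))
  where
  copy : V → Maybe (Fin (suc k) × V)
  copy v = just (i₀ , v)
  shifted-ranking : Is2Ranking U (λ v → suc (φ (copy v) ∸ k₀))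
  shifted-ranking = ranking-shift U (φ ∘ copy) k₀ (k₀≤φ ∘ copy)
                      (ranking-pullback U (ApexCopies U k) copy (copy-inj k i₀) (refl ,_) φ rk)
  h≤c∸k₀ : h ≤ φ nothing ∸ k₀
  h≤c∸k₀ = χ₂U≥h (φ nothing ∸ k₀) _ shifted-ranking
             (λ v → s≤s z≤n , ∸-monoˡ-< (below v) (k₀≤φ (copy v)))

lemma18 : (h k : ℕ) → 1 ≤ h → 1 ≤ k →
    (n : ℕ) (U : Graph (Fin n)) → Chi2≥ U h →
    (k₀ : ℕ) → 1 ≤ k₀ → k₀ ≤ k →
    (φ : Maybe (Fin (suc k) × Fin n) → ℕ) → Is2Ranking (ApexCopies U k) φ →
    (∀ v → k₀ ≤ φ v × φ v ≤ k) →
    k₀ + h ≤ φ nothing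
lemma18 h k _ _ n U χ₂U≥h k₀ 1≤k₀ _ φ rk range =
  apex-above-low-copy U h k k₀ χ₂U≥h φ rk (proj₁ ∘ range) i₀ below
  where
  colours-positive : ∀ v → 1 ≤ φ v × φ v ≤ k
  colours-positive v = ≤-trans 1≤k₀ (proj₁ (range v)) , proj₂ (range v)
  low-copy : ∃ λ i₀ → ∀ v → φ (just (i₀ , v)) < φ nothing
  low-copy = some-copy-below-apex U k φ rk colours-positive
  i₀ : Fin (suc k)
  i₀ = proj₁ low-copy
  below : ∀ v → φ (just (i₀ , v)) < φ nothing
  below = proj₂ low-copy
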